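{- Let $(G_1,\sigma_1,\prec_1)$ and $(G_2,\sigma_2,\prec_2)$ be admissible UPO-graphs such that $G_1$ has $n$ output edges $o_1\prec_1\cdots\prec_1 o_n$ and $G_2$ has $n$ input edges $i_1\prec_2\cdots\prec_2 i_n$, and let $G=G_2\circ G_1$ with composed linear order $\prec=\prec_2\circ\prec_1$. Then $\prec$ satisfies the nesting condition: whenever $e_1,e,e_2\in E(G)$ with $e_1\prec e\prec e_2$ and $e_1,e_2$ adjacent (sharing an endpoint), then: if $t(e_1)=t(e_2)=v$, then $I(t(e))\subseteq\overline{I(v)}$; if $s(e_1)=s(e_2)=v$, then $O(s(e))\subseteq\overline{O(v)}$; if $t(e_1)=s(e_2)=v$, then either $I(t(e))\subseteq\overline{I(v)}$ or $O(s(e))\subseteq\overline{O(v)}$ (convex hulls taken in $(E(G),\prec)$).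
   Context: Directed graphs are finite, may have multiple edges, and each edge $e$ has source $s(e)$ and target $t(e)$. $I(v)$, $O(v)$ denote the incoming and outgoing edges of a vertex $v$, and $E(v)=I(v)\cup O(v)$. $e_1\to e_2$ means there is a directed path starting with edge $e_1$ and ending with edge $e_2$. For a subset $X$ of a finite linearly ordered set, $\overline{X}$ is the set of elements between $\min X$ and $\max X$ inclusive. An upward planar order on a finite acyclic directed graph $G$ is a linear order $\prec$ on $E(G)$ such that (i) $e_1\to e_2$ implies $e_1\prec e_2$; (ii) for every vertex $v$, $\overline{I(v)}\cap\overline{O(v)}=\emptyset$ and $\overline{E(v)}=\overline{I(v)}\sqcup\overline{O(v)}$; (iii) for any vertices $v_1,v_2$, $I(v_1)\cap\overline{I(v_2)}\neq\emptyset$ implies $\overline{I(v_1)}\subseteq\overline{I(v_2)}$, and $O(v_1)\cap\overline{O(v_2)}\neq\emptyset$ implies $\overline{O(v_1)}\subseteq\overline{O(v_2)}$. A progressive graph $(G,\sigma)$ is a finite acyclic directed graph $G$ with a distinguished subset $\sigma$ of vertices of degree one (boundary vertices); the other vertices are inner vertices. Boundary sources are input vertices, boundary sinks are output vertices. Edges starting at a boundary vertex are input edges, forming $I(G)$; edges ending at a boundary vertex are output edges, forming $O(G)$. An upward planar order $\prec$ on $(G,\sigma)$ is admissible if for every inner vertex $v$, $I(G)\cap\overline{O(v)}=\emptyset$ and $O(G)\cap\overline{I(v)}=\emptyset$; $(G,\sigma,\prec)$ is then an admissible UPO-graph. Composition: given $(G_1,\sigma_1,\prec_1)$ with output edges $o_1\prec_1\cdots\prec_1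 o_n$ and $(G_2,\sigma_2,\prec_2)$ with input edges $i_1\prec_2\cdots\prec_2 i_n$, the graph $G=G_2\circ G_1$ is obtained by deleting the output vertices of $G_1$ and the input vertices of $G_2$ and, for each $k$, replacing $o_k$ and $i_k$ by a single edge $\overline{e_k}$ with source $s(o_k)$ and target $t(i_k)$; its boundary $\sigma$ consists of the input vertices of $G_1$ and the output vertices of $G_2$. Write $(E(G_1),\prec_1)$ as the consecutive blocks $Q_1,\{o_1\},Q_2,\{o_2\},\dots,Q_n,\{o_n\},Q_{n+1}$ (so $Q_1$ is the set of edges before $o_1$, $Q_k$ those strictly between $o_{k-1}$ and $o_k$, $Q_{n+1}$ those after $o_n$), and $(E(G_2),\prec_2)$ as $P_0,\{i_1\},P_1,\dots,\{i_n\},P_n$ similarly. The composed order $\prec=\prec_2\circ\prec_1$ on $E(G)$ is the linear order whose consecutive blocks are $P_0,Q_1,\{\overline{e_1}\},P_1,Q_2,\{\overline{e_2}\},P_2,\dots,Q_n,\{\overline{e_n}\},P_n,Q_{n+1}$, with each $Q_k$ ordered by $\prec_1$ and each $P_k$ by $\prec_2$. -}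

module Defs where

open import Data.Nat using (ℕ)
open import Data.Fin as Fin using (Fin)
open import Data.Bool using (Bool; true; false; if_then_else_)
open import Data.List using (List; []; _∷_; _++_; map; length; zipWith; lookup; allFin; concat; filterᵇ)
open import Data.Product using (Σ; ∃; _×_; _,_; proj₁; proj₂)
open import Data.Sum using (_⊎_; inj₁; inj₂)
open import Relation.Binary.PropositionalEquality using (_≡_)
open import Relation.Nullary using (¬_)
open import Function.Bundles using (_↔_; Inverse)

module EdgeNotions {nE : ℕ} {V : Set} (s t : Fin nE → V)
                   (_≺_ : Fin nE → Fin nE → Set) where

  EdgeSet : Set₁
  EdgeSet = Fin nE → Set

  In : V → EdgeSet
  In v e = t e ≡ v

  Out : V → EdgeSet
  Out v e = s e ≡ v

  Inc : V → EdgeSet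
  Inc v e = In v e ⊎ Out v e

  _≼_ : Fin nE → Fin nE → Set
  a ≼ b = a ≡ b ⊎ a ≺ b

  hull : EdgeSet → EdgeSet
  hull X e = Σ (Fin nE) λ a → Σ (Fin nE) λ b → X a × X b × a ≼ e × e ≼ b

  _⊆_ : EdgeSet → EdgeSet → Set
  X ⊆ Y = ∀ e → X e → Y e

  data _⇝_ : Fin nE → Fin nE → Set where
    step : ∀ {e₁ e₂} → t e₁ ≡ s e₂ → e₁ ⇝ e₂
    cons : ∀ {e₁ e e₂} → t e₁ ≡ s e → e ⇝ e₂ → e₁ ⇝ e₂

  Acyclic : Set
  Acyclic = (∀ e → ¬ (t e ≡ s e)) × (∀ e₁ e₂ → e₁ ⇝ e₂ → ¬ (t e₂ ≡ s e₁))

  -- upward planar order, conditions (i),(ii),(iii)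
  UPO : Set
  UPO =
      (∀ e₁ e₂ → e₁ ⇝ e₂ → e₁ ≺ e₂)
    × (∀ v → (∀ e → ¬ (hull (In v) e × hull (Out v) e))
           × (∀ e → hull (Inc v) e → hull (In v) e ⊎ hull (Out v) e)
           × (∀ e → hull (In v) e ⊎ hull (Out v) e → hull (Inc v) e))
    × (∀ v₁ v₂ → ((Σ (Fin nE) λ e → In v₁ e × hull (In v₂) e) → hull (In v₁) ⊆ hull (In v₂))
               × ((Σ (Fin nE) λ e → Out v₁ e × hull (Out v₂) e) → hull (Out v₁) ⊆ hull (Out v₂)))

  Nesting : Set
  Nesting = ∀ e₁ e e₂ → e₁ ≺ e → e ≺ e₂ →
      (∀ v → t e₁ ≡ v → t e₂ ≡ v → In (t e) ⊆ hull (In v))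
    × (∀ v → s e₁ ≡ v → s e₂ ≡ v → Out (s e) ⊆ hull (Out v))
    × (∀ v → t e₁ ≡ v → s e₂ ≡ v → (In (t e) ⊆ hull (In v)) ⊎ (Out (s e) ⊆ hull (Out v)))

-- Vertices Fin nV, edges Fin nE, boundary σ (as a Bool-valued predicate),
-- linear order ≺ given by the position map pos (e ≺ e' iff pos e < pos e').

record OGraph : Set where
  field
    nV  : ℕ
    nE  : ℕ
    src : Fin nE → Fin nV
    tgt : Fin nE → Fin nV
    σ   : Fin nV → Bool
    pos : Fin nE ↔ Fin nE

  _≺_ : Fin nE → Fin nE → Set
  a ≺ b = Inverse.to pos a Fin.< Inverse.to pos b

  open EdgeNotions src tgt _≺_ public

  IG : EdgeSet
  IG e = σ (src e) ≡ true

  OG : EdgeSet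
  OG e = σ (tgt e) ≡ true

  -- boundary vertices have degree one (loops are excluded by acyclicity)
  Progressive : Set
  Progressive = Acyclic
    × (∀ v → σ v ≡ true → Σ (Fin nE) λ e → Inc v e × (∀ e' → Inc v e' → e' ≡ e))

  Admissible : Set
  Admissible = ∀ v → σ v ≡ false →
    (∀ e → IG e → ¬ hull (Out v) e) × (∀ e → OG e → ¬ hull (In v) e)

  AdmissibleUPO : Set
  AdmissibleUPO = Progressive × UPO × Admissible

  sortedEdges : List (Fin nE)
  sortedEdges = map (Inverse.from pos) (allFin nE)

  isInputEdge : Fin nE → Bool
  isInputEdge e = σ (src e)

  isOutputEdge : Fin nE → Bool
  isOutputEdge e = σ (tgt e)

  inputEdges : List (Fin nE)
  inputEdges = filterᵇ isInputEdge sortedEdges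

  outputEdges : List (Fin nE)
  outputEdges = filterᵇ isOutputEdge sortedEdges

-- split p xs = (X₀ , [(x₁ , X₁) , … , (xₙ , Xₙ)]) where x₁,…,xₙ are the
-- elements satisfying p, in order, and the Xₖ are the consecutive blocks.
split : {A : Set} → (A → Bool) → List A → List A × List (A × List A)
split p [] = [] , []
split p (x ∷ xs) with split p xs
... | seg , rest = if p x then ([] , (x , seg) ∷ rest) else (x ∷ seg , rest)

data CEdge (m₁ m₂ : ℕ) : Set where
  left  : Fin m₁ → CEdge m₁ m₂          -- non-output edge of G₁
  right : Fin m₂ → CEdge m₁ m₂          -- non-input edge of G₂
  glued : Fin m₁ → Fin m₂ → CEdge m₁ m₂ -- \overline{e_k} from (o_k , i_k)

module Compose (G₁ G₂ : OGraph) where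
  private
    module A = OGraph G₁
    module B = OGraph G₂

  -- Q₁ , [(o₁,Q₂),…,(oₙ,Qₙ₊₁)]
  Qblocks : List (Fin A.nE) × List (Fin A.nE × List (Fin A.nE))
  Qblocks = split A.isOutputEdge A.sortedEdges

  -- P₀ , [(i₁,P₁),…,(iₙ,Pₙ)]
  Pblocks : List (Fin B.nE) × List (Fin B.nE × List (Fin B.nE))
  Pblocks = split B.isInputEdge B.sortedEdges

  -- P₀,Q₁,ē₁,P₁,Q₂,ē₂,P₂,…,Qₙ,ēₙ,Pₙ,Qₙ₊₁
  edgeList : List (CEdge A.nE B.nE)
  edgeList = map right (proj₁ Pblocks) ++ map left (proj₁ Qblocks)
    ++ concat (zipWith (λ oQ iP → glued (proj₁ oQ) (proj₁ iP)
                                   ∷ map right (proj₂ iP) ++ map left (proj₂ oQ))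
                       (proj₂ Qblocks) (proj₂ Pblocks))

  -- E(G) = Fin nE, ordered by position in edgeList
  nE : ℕ
  nE = length edgeList

  -- vertices of G are among Fin nV₁ ⊎ Fin nV₂ (deleted vertices are never endpoints)
  Vtx : Set
  Vtx = Fin A.nV ⊎ Fin B.nV

  srcC : CEdge A.nE B.nE → Vtx
  srcC (left e)    = inj₁ (A.src e)
  srcC (right e)   = inj₂ (B.src e)
  srcC (glued o i) = inj₁ (A.src o)

  tgtC : CEdge A.nE B.nE → Vtx
  tgtC (left e)    = inj₁ (A.tgt e)
  tgtC (right e)   = inj₂ (B.tgt e)
  tgtC (glued o i) = inj₂ (B.tgt i)

  src : Fin nE → Vtx
  src e = srcC (lookup edgeList e)

  tgt : Fin nE → Vtx
  tgt e = tgtC (lookup edgeList e)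

  _≺_ : Fin nE → Fin nE → Set
  a ≺ b = a Fin.< b

  open EdgeNotions src tgt _≺_ public

module Submission where

-- In the composed order the G₁-parts of the composed edges (left edges and the o_k of glued
-- edges) occur in ≺₁-order and exhaust E(G₁), and likewise for G₂.  Hence hulls in G₁ or G₂
-- transfer to G, and when e comes from the same graph as the vertex v the claims follow from
-- conditions (ii) and (iii) for ≺₁ or ≺₂.  The interleaving has one combinatorial property: a
-- right edge never follows a left edge without a glued edge ē_k in between.  With admissibility
-- this shows that no edge ending in G₂ separates two edges entering the same vertex of G₁ (ē_k
-- would put the output edge o_k in the incoming hull of an inner vertex), and dually, which
-- handles e from the other graph when t(e₁) = t(e₂) or s(e₁) = s(e₂).  When t(e₁) = s(e₂),
-- condition (ii) and admissibility put o_k (resp. i_k) in the outgoing (incoming) hull of v,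
-- which yields an edge at v on the far side of e to bracket the edges adjacent to e.

open import Defs
open import Data.Nat using (ℕ; suc; s≤s; z≤n)
open import Data.Nat.Properties using (suc-injective)
open import Data.Fin as Fin using (Fin; zero; suc)
import Data.Fin.Properties as Finₚ
open import Data.Bool using (Bool; true; false)
open import Data.Maybe using (Maybe; just; nothing)
open import Data.List
  using (List; []; _∷_; _++_; map; mapMaybe; length; lookup; concat; zipWith; filterᵇ)
open import Data.List.Properties
  using (++-assoc; mapMaybe-++; mapMaybe-map; mapMaybe-cong; mapMaybe-nothing; mapMaybe-map-retract)
open import Data.Sum.Properties using (inj₁-injective; inj₂-injective)
open import Data.List.Relation.Unary.All as All using (All; []; _∷_)
open import Data.List.Relation.Unary.AllPairs as AllPairs using (AllPairs; []; _∷_)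
open import Data.List.Relation.Unary.Any using (here; there)
open import Data.List.Membership.Propositional using (_∈_)
open import Data.Product using (Σ; ∃; _×_; _,_; proj₁; proj₂; uncurry)
open import Data.Sum using (_⊎_; inj₁; inj₂)
open import Data.Empty using (⊥; ⊥-elim)
open import Relation.Binary.Definitions using (tri<; tri≈; tri>)
open import Relation.Binary.PropositionalEquality
open ≡-Reasoning
open import Relation.Nullary using (¬_)
open import Function using (_∘_)
open import Function.Bundles using (Inverse)
import Data.List.Relation.Unary.AllPairs.Properties as AllPairsₚ
import Data.List.Relation.Unary.All.Properties as Allₚ
open import Data.List.Membership.Propositional.Properties using (∈-map⁺; ∈-allFin; ∈-lookup)

module _ {A : Set} (p : A → Bool) where

  split-concat : ∀ xs →
    proj₁ (split p xs) ++ concat (map (uncurry _∷_) (proj₂ (split p xs))) ≡ xs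
  split-concat [] = refl
  split-concat (x ∷ xs) with split p xs | split-concat xs
  ... | seg , rest | ih with p x
  ... | true  = cong (x ∷_) ih
  ... | false = cong (x ∷_) ih

  length-split : ∀ xs → length (proj₂ (split p xs)) ≡ length (filterᵇ p xs)
  length-split [] = refl
  length-split (x ∷ xs) with split p xs | length-split xs
  ... | seg , rest | ih with p x
  ... | true  = cong suc ih
  ... | false = ih

  Block : A × List A → Set
  Block xQ = p (proj₁ xQ) ≡ true × All (λ x → p x ≡ false) (proj₂ xQ)

  SplitBlocks : List A × List (A × List A) → Set
  SplitBlocks r = All (λ x → p x ≡ false) (proj₁ r) × All Block (proj₂ r)

  split-blocks : ∀ xs → SplitBlocks (split p xs)
  split-blocks [] = [] , []
  split-blocks (x ∷ xs) with split p xs | split-blocks xs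
  ... | seg , rest | seg-false , rest-ok with p x in px
  ... | true  = [] , (px , seg-false) ∷ rest-ok
  ... | false = px ∷ seg-false , rest-ok

module _ {A B : Set} (f : A → Maybe B) where

  lookup-mapMaybe-All : ∀ {P : B → Set} xs → All P (mapMaybe f xs) →
    ∀ i {b} → f (lookup xs i) ≡ just b → P b
  lookup-mapMaybe-All (x ∷ xs) ps zero fx with f x
  lookup-mapMaybe-All (x ∷ xs) (p ∷ ps) zero refl | just _ = p
  lookup-mapMaybe-All (x ∷ xs) ps (suc i) fi with f x
  ... | just _  = lookup-mapMaybe-All xs (All.tail ps) i fi
  ... | nothing = lookup-mapMaybe-All xs ps i fi

  lookup-mapMaybe-AllPairs : ∀ {R : B → B → Set} xs → AllPairs R (mapMaybe f xs) →
    ∀ {i j b c} → i Fin.< j → f (lookup xs i) ≡ just b → f (lookup xs j) ≡ just c → R b c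
  lookup-mapMaybe-AllPairs (x ∷ xs) rs {zero} {suc j} _ fx fj with f x
  lookup-mapMaybe-AllPairs (x ∷ xs) (r ∷ _) {zero} {suc j} _ refl fj | just _ =
    lookup-mapMaybe-All xs r j fj
  lookup-mapMaybe-AllPairs (x ∷ xs) rs {suc i} {suc j} (s≤s i<j) fi fj with f x
  ... | just _  = lookup-mapMaybe-AllPairs xs (AllPairs.tail rs) i<j fi fj
  ... | nothing = lookup-mapMaybe-AllPairs xs rs i<j fi fj

  ∈-mapMaybe⁻ : ∀ xs {b} → b ∈ mapMaybe f xs → ∃ λ i → f (lookup xs i) ≡ just b
  ∈-mapMaybe⁻ (x ∷ xs) b∈ with f x in fx
  ∈-mapMaybe⁻ (x ∷ xs) (here refl) | just _ = zero , fx
  ∈-mapMaybe⁻ (x ∷ xs) (there b∈) | just _ = let i , fi = ∈-mapMaybe⁻ xs b∈ in suc i , fi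
  ∈-mapMaybe⁻ (x ∷ xs) b∈          | nothing = let i , fi = ∈-mapMaybe⁻ xs b∈ in suc i , fi

module _ {A B C : Set} (f : B → Maybe C) (g : A → B) where

  mapMaybe-map-++-nothing : (∀ x → f (g x) ≡ nothing) →
    ∀ xs ys → mapMaybe f (map g xs ++ ys) ≡ mapMaybe f ys
  mapMaybe-map-++-nothing fg≡ xs ys = begin
    mapMaybe f (map g xs ++ ys)             ≡⟨ mapMaybe-++ f (map g xs) ys ⟩
    mapMaybe f (map g xs) ++ mapMaybe f ys  ≡⟨ cong (_++ mapMaybe f ys) map-g-dropped ⟩
    mapMaybe f ys                           ∎
    where
    map-g-dropped : mapMaybe f (map g xs) ≡ []
    map-g-dropped = trans (mapMaybe-map f g xs) (trans (mapMaybe-cong fg≡ xs) (mapMaybe-nothing xs))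

module _ {A B : Set} (f : B → Maybe A) (g : A → B) where

  mapMaybe-map-++-just : (∀ x → f (g x) ≡ just x) →
    ∀ xs ys → mapMaybe f (map g xs ++ ys) ≡ xs ++ mapMaybe f ys
  mapMaybe-map-++-just fg≡ xs ys =
    trans (mapMaybe-++ f (map g xs) ys) (cong (_++ mapMaybe f ys) (mapMaybe-map-retract fg≡ xs))

inj₁≢inj₂ : ∀ {A B : Set} {a : A} {b : B} → inj₁ a ≢ inj₂ b
inj₁≢inj₂ ()

≼-<-trans : ∀ {n} {a b d : Fin n} → a ≡ b ⊎ a Fin.< b → b Fin.< d → a Fin.< d
≼-<-trans (inj₁ refl) b<d = b<d
≼-<-trans (inj₂ a<b)  b<d = Finₚ.<-trans a<b b<d

<-≼-trans : ∀ {n} {a b d : Fin n} → a Fin.< b → b ≡ d ⊎ b Fin.< d → a Fin.< d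
<-≼-trans a<b (inj₁ refl) = a<b
<-≼-trans a<b (inj₂ b<d)  = Finₚ.<-trans a<b b<d

module _ {n : ℕ} {X Y : Fin n → Set}
         (unseparated : ∀ {x x′ y} → X x → X x′ → Y y → x Fin.< y → y Fin.< x′ → ⊥)
         (disjoint : ∀ {x} → X x → Y x → ⊥) where

  same-side : ∀ {x x′ y} → X x → X x′ → Y y →
    (y Fin.< x → y Fin.< x′) × (x Fin.< y → x′ Fin.< y)
  same-side {x} {x′} {y} Xx Xx′ Yy = before , after
    where
    before : y Fin.< x → y Fin.< x′
    before y<x with Finₚ.<-cmp y x′
    ... | tri< y<x′ _ _ = y<x′
    ... | tri≈ _ refl _ = ⊥-elim (disjoint Xx′ Yy)
    ... | tri> _ _ x′<y = ⊥-elim (unseparated Xx′ Xx Yy x′<y y<x)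
    after : x Fin.< y → x′ Fin.< y
    after x<y with Finₚ.<-cmp x′ y
    ... | tri< x′<y _ _ = x′<y
    ... | tri≈ _ refl _ = ⊥-elim (disjoint Xx′ Yy)
    ... | tri> _ _ y<x′ = ⊥-elim (unseparated Xx Xx′ Yy x<y y<x′)

module EdgeHull {nE : ℕ} {V : Set} (s t : Fin nE → V) (_≺_ : Fin nE → Fin nE → Set) where
  open EdgeNotions s t _≺_

  ⊆-hull : ∀ X → X ⊆ hull X
  ⊆-hull X e Xe = e , e , Xe , Xe , inj₁ refl , inj₁ refl

  between⇒hull : ∀ {X a₁ a a₂} → X a₁ → X a₂ → a₁ ≺ a → a ≺ a₂ → hull X a
  between⇒hull {a₁ = a₁} {a₂ = a₂} X₁ X₂ a₁≺a a≺a₂ = a₁ , a₂ , X₁ , X₂ , inj₂ a₁≺a , inj₂ a≺a₂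

module UPOProperties (G : OGraph) (G-upo : OGraph.AdmissibleUPO G) where
  open OGraph G
  open EdgeHull src tgt _≺_ public

  private
    upo : UPO
    upo = proj₁ (proj₂ G-upo)

    admissible : Admissible
    admissible = proj₂ (proj₂ G-upo)

    hull-Inc-split : ∀ v e → hull (Inc v) e → hull (In v) e ⊎ hull (Out v) e
    hull-Inc-split v = proj₁ (proj₂ (proj₁ (proj₂ upo) v))

    hull-In-laminar : ∀ v₁ v₂ → (Σ (Fin nE) λ e → In v₁ e × hull (In v₂) e) →
      hull (In v₁) ⊆ hull (In v₂)
    hull-In-laminar v₁ v₂ = proj₁ (proj₂ (proj₂ upo) v₁ v₂)

    hull-Out-laminar : ∀ v₁ v₂ → (Σ (Fin nE) λ e → Out v₁ e × hull (Out v₂) e) →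
      hull (Out v₁) ⊆ hull (Out v₂)
    hull-Out-laminar v₁ v₂ = proj₂ (proj₂ (proj₂ upo) v₁ v₂)

  sortedEdges-sorted : AllPairs _≺_ sortedEdges
  sortedEdges-sorted = AllPairsₚ.map⁺ (AllPairsₚ.tabulate⁺-< λ {i} {j} i<j →
    subst₂ Fin._<_ (sym (Inverse.strictlyInverseˡ pos i)) (sym (Inverse.strictlyInverseˡ pos j))
           i<j)

  ∈-sortedEdges : ∀ a → a ∈ sortedEdges
  ∈-sortedEdges a = subst (_∈ sortedEdges) (Inverse.strictlyInverseʳ pos a)
    (∈-map⁺ (Inverse.from pos) (∈-allFin (Inverse.to pos a)))

  hull-In-nested : ∀ {v a} → hull (In v) a → In (tgt a) ⊆ hull (In v)
  hull-In-nested {v} {a} a∈ f tf≡ =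
    hull-In-laminar (tgt a) v (a , refl , a∈) f (⊆-hull (In (tgt a)) f tf≡)

  hull-Out-nested : ∀ {v a} → hull (Out v) a → Out (src a) ⊆ hull (Out v)
  hull-Out-nested {v} {a} a∈ f sf≡ =
    hull-Out-laminar (src a) v (a , refl , a∈) f (⊆-hull (Out (src a)) f sf≡)

  between-In-Out⇒hull : ∀ {v a₁ a a₂} → tgt a₁ ≡ v → src a₂ ≡ v → a₁ ≺ a → a ≺ a₂ →
    hull (In v) a ⊎ hull (Out v) a
  between-In-Out⇒hull {v} {a = a} t₁ s₂ a₁≺a a≺a₂ =
    hull-Inc-split v a (between⇒hull (inj₁ t₁) (inj₂ s₂) a₁≺a a≺a₂)

  output∉hull-In : ∀ {v e} → σ v ≡ false → OG e → ¬ hull (In v) e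
  output∉hull-In {v} {e} inner = proj₂ (admissible v inner) e

  input∉hull-Out : ∀ {v e} → σ v ≡ false → IG e → ¬ hull (Out v) e
  input∉hull-Out {v} {e} inner = proj₁ (admissible v inner) e

module HullTransfer (G : OGraph) {N : ℕ} {V : Set} (s t : Fin N → V)
    (φ : Fin N → Maybe (Fin (OGraph.nE G)))
    (φ-monotone : ∀ {p q a b} → p Fin.< q → φ p ≡ just a → φ q ≡ just b → OGraph._≺_ G a b)
    where
  private module G = OGraph G
  open EdgeNotions s t Fin._<_

  ≼-reflect : ∀ {p q a b} → φ p ≡ just a → φ q ≡ just b → a G.≼ b → p ≼ q
  ≼-reflect {p} {q} φp φq a≼b with Finₚ.<-cmp p q
  ... | tri< p<q _ _ = inj₂ p<q
  ... | tri≈ _ p≡q _ = inj₁ p≡q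
  ... | tri> _ _ q<p with a≼b
  ...   | inj₁ refl = ⊥-elim (Finₚ.<-irrefl refl (φ-monotone q<p φq φp))
  ...   | inj₂ a≺b  = ⊥-elim (Finₚ.<-asym a≺b (φ-monotone q<p φq φp))

  hull-transfer : ∀ {X Y q b} → (∀ {a} → X a → ∃ λ p → φ p ≡ just a × Y p) →
    φ q ≡ just b → G.hull X b → hull Y q
  hull-transfer lift φq (a₁ , a₂ , X₁ , X₂ , a₁≼b , b≼a₂) =
    let p₁ , φp₁ , Y₁ = lift X₁
        p₂ , φp₂ , Y₂ = lift X₂
    in p₁ , p₂ , Y₁ , Y₂ , ≼-reflect φp₁ φq a₁≼b , ≼-reflect φq φp₂ b≼a₂

module _ {m₁ m₂ : ℕ} where

  edge₁ : CEdge m₁ m₂ → Maybe (Fin m₁)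
  edge₁ (left a)    = just a
  edge₁ (right b)   = nothing
  edge₁ (glued o i) = just o

  edge₂ : CEdge m₁ m₂ → Maybe (Fin m₂)
  edge₂ (left a)    = nothing
  edge₂ (right b)   = just b
  edge₂ (glued o i) = just i

  Glued : CEdge m₁ m₂ → Set
  Glued x = Σ (Fin m₁) λ o → Σ (Fin m₂) λ i → x ≡ glued o i

  -- The flag records whether a left edge has occurred since the last glued edge.
  data Separated : Bool → List (CEdge m₁ m₂) → Set where
    []     : ∀ {s} → Separated s []
    left∷  : ∀ {s a xs} → Separated true xs → Separated s (left a ∷ xs)
    glued∷ : ∀ {s o i xs} → Separated false xs → Separated s (glued o i ∷ xs)
    right∷ : ∀ {b xs} → Separated false xs → Separated false (right b ∷ xs)

  glued-before-right : ∀ {xs} → Separated true xs → ∀ q {b} → lookup xs q ≡ right b →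
    ∃ λ g → g Fin.< q × Glued (lookup xs g)
  glued-before-right (left∷ sep) (suc q) xq =
    let g , g<q , gg = glued-before-right sep q xq in suc g , s≤s g<q , gg
  glued-before-right (glued∷ sep) (suc q) xq = zero , s≤s z≤n , _ , _ , refl

  separated-tail : ∀ {s x xs} → Separated s (x ∷ xs) → ∃ λ s′ → Separated s′ xs
  separated-tail (left∷ sep)  = _ , sep
  separated-tail (glued∷ sep) = _ , sep
  separated-tail (right∷ sep) = _ , sep

  glued-between : ∀ {s xs} → Separated s xs → ∀ {p q a b} → p Fin.< q →
    lookup xs p ≡ left a → lookup xs q ≡ right b →
    ∃ λ g → p Fin.< g × g Fin.< q × Glued (lookup xs g)
  glued-between (left∷ sep) {zero} {suc q} _ _ xq =
    let g , g<q , gg = glued-before-right sep q xq in suc g , s≤s z≤n , s≤s g<q , gg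
  glued-between {xs = _ ∷ _} sep {suc p} {suc q} (s≤s p<q) xp xq =
    let g , p<g , g<q , gg = glued-between (proj₂ (separated-tail sep)) p<q xp xq
    in suc g , s≤s p<g , s≤s g<q , gg

module ComposedEdges (G₁ G₂ : OGraph) where
  private
    module A = OGraph G₁
    module B = OGraph G₂
  open Compose G₁ G₂

  tgt≡inj₁ : ∀ x {v} → tgtC x ≡ inj₁ v → ∃ λ a → x ≡ left a × A.tgt a ≡ v
  tgt≡inj₁ (left a) eq = a , refl , inj₁-injective eq

  src≡inj₂ : ∀ x {w} → srcC x ≡ inj₂ w → ∃ λ b → x ≡ right b × B.src b ≡ w
  src≡inj₂ (right b) eq = b , refl , inj₂-injective eq

  src≡inj₁ : ∀ x {v} → srcC x ≡ inj₁ v → ∃ λ a → edge₁ x ≡ just a × A.src a ≡ v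
  src≡inj₁ (left a)    eq = a , refl , inj₁-injective eq
  src≡inj₁ (glued o i) eq = o , refl , inj₁-injective eq

  tgt≡inj₂ : ∀ x {w} → tgtC x ≡ inj₂ w → ∃ λ b → edge₂ x ≡ just b × B.tgt b ≡ w
  tgt≡inj₂ (right b)   eq = b , refl , inj₂-injective eq
  tgt≡inj₂ (glued o i) eq = i , refl , inj₂-injective eq

  edge₁⇒src : ∀ x {a} → edge₁ x ≡ just a → srcC x ≡ inj₁ (A.src a)
  edge₁⇒src (left a)    refl = refl
  edge₁⇒src (glued o i) refl = refl

  edge₂⇒tgt : ∀ x {b} → edge₂ x ≡ just b → tgtC x ≡ inj₂ (B.tgt b)
  edge₂⇒tgt (right b)   refl = refl
  edge₂⇒tgt (glued o i) refl = refl

  edge₁-view : ∀ (x : CEdge A.nE B.nE) {a} → edge₁ x ≡ just a →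
    x ≡ left a ⊎ ∃ λ i → x ≡ glued a i
  edge₁-view (left a)    refl = inj₁ refl
  edge₁-view (glued o i) refl = inj₂ (i , refl)

  edge₂-view : ∀ (x : CEdge A.nE B.nE) {b} → edge₂ x ≡ just b →
    x ≡ right b ⊎ ∃ λ o → x ≡ glued o b
  edge₂-view (right b)   refl = inj₁ refl
  edge₂-view (glued o i) refl = inj₂ (o , refl)

  -- The block ē_k, P_k, Q_{k+1} of the composed order, written as in Compose.edgeList.
  chunk : Fin A.nE × List (Fin A.nE) → Fin B.nE × List (Fin B.nE) → List (CEdge A.nE B.nE)
  chunk oQ iP = glued (proj₁ oQ) (proj₁ iP) ∷ map right (proj₂ iP) ++ map left (proj₂ oQ)

  separated-edgeList : Separated false edgeList
  separated-edgeList =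
    rights (proj₁ Pblocks) (lefts (proj₁ Qblocks) (chunks (proj₂ Qblocks) (proj₂ Pblocks)) false)
    where
    rights : ∀ (P : List (Fin B.nE)) {ys} → Separated false ys → Separated false (map right P ++ ys)
    rights []      sep = sep
    rights (b ∷ P) sep = right∷ (rights P sep)

    lefts : ∀ (Q : List (Fin A.nE)) {ys} → (∀ s → Separated s ys) →
      ∀ s → Separated s (map left Q ++ ys)
    lefts []      sep s = sep s
    lefts (a ∷ Q) sep s = left∷ (lefts Q sep true)

    chunks : ∀ Qs Ps s → Separated s (concat (zipWith chunk Qs Ps))
    chunks ((o , Q) ∷ Qs) ((i , P) ∷ Ps) s =
      glued∷ (subst (Separated false) (sym (++-assoc (map right P) (map left Q) _))
        (rights P (lefts Q (chunks Qs Ps) false)))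
    chunks []      _       s = []
    chunks (_ ∷ _) []      s = []

  Classified : CEdge A.nE B.nE → Set
  Classified (left a)    = A.isOutputEdge a ≡ false
  Classified (right b)   = B.isInputEdge b ≡ false
  Classified (glued o i) = A.isOutputEdge o ≡ true × B.isInputEdge i ≡ true

  classified-edgeList : All Classified edgeList
  classified-edgeList
    with split-blocks A.isOutputEdge A.sortedEdges | split-blocks B.isInputEdge B.sortedEdges
  ... | Q-inner , Qs-ok | P-inner , Ps-ok =
    Allₚ.++⁺ (Allₚ.map⁺ P-inner) (Allₚ.++⁺ (Allₚ.map⁺ Q-inner) (Allₚ.concat⁺ (chunks Qs-ok Ps-ok)))
    where
    chunks : ∀ {Qs Ps} → All (Block A.isOutputEdge) Qs → All (Block B.isInputEdge) Ps →
      All (All Classified) (zipWith chunk Qs Ps)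
    chunks ((o-out , Q-inner) ∷ Qs-ok) ((i-in , P-inner) ∷ Ps-ok) =
      ((o-out , i-in) ∷ Allₚ.++⁺ (Allₚ.map⁺ P-inner) (Allₚ.map⁺ Q-inner)) ∷ chunks Qs-ok Ps-ok
    chunks []      _       = []
    chunks (_ ∷ _) []      = []

  private
    P₀ = proj₁ Pblocks
    Ps = proj₂ Pblocks
    Q₀ = proj₁ Qblocks
    Qs = proj₂ Qblocks

  mapMaybe-edge₁ : length Qs ≡ length Ps → mapMaybe edge₁ edgeList ≡ A.sortedEdges
  mapMaybe-edge₁ Qs≡Ps = begin
    mapMaybe edge₁ (map right P₀ ++ map left Q₀ ++ concat (zipWith chunk Qs Ps))
      ≡⟨ mapMaybe-map-++-nothing edge₁ right (λ _ → refl) P₀ _ ⟩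
    mapMaybe edge₁ (map left Q₀ ++ concat (zipWith chunk Qs Ps))
      ≡⟨ mapMaybe-map-++-just edge₁ left (λ _ → refl) Q₀ _ ⟩
    Q₀ ++ mapMaybe edge₁ (concat (zipWith chunk Qs Ps))
      ≡⟨ cong (Q₀ ++_) (chunks Qs Ps Qs≡Ps) ⟩
    Q₀ ++ concat (map (uncurry _∷_) Qs)
      ≡⟨ split-concat A.isOutputEdge A.sortedEdges ⟩
    A.sortedEdges ∎
    where
    chunks : ∀ Qs Ps → length Qs ≡ length Ps →
      mapMaybe edge₁ (concat (zipWith chunk Qs Ps)) ≡ concat (map (uncurry _∷_) Qs)
    chunks [] [] _ = refl
    chunks ((o , Q) ∷ Qs) ((i , P) ∷ Ps) Qs≡Ps = cong (o ∷_) (begin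
      mapMaybe edge₁ ((map right P ++ map left Q) ++ concat (zipWith chunk Qs Ps))
        ≡⟨ cong (mapMaybe edge₁) (++-assoc (map right P) (map left Q) _) ⟩
      mapMaybe edge₁ (map right P ++ map left Q ++ concat (zipWith chunk Qs Ps))
        ≡⟨ mapMaybe-map-++-nothing edge₁ right (λ _ → refl) P _ ⟩
      mapMaybe edge₁ (map left Q ++ concat (zipWith chunk Qs Ps))
        ≡⟨ mapMaybe-map-++-just edge₁ left (λ _ → refl) Q _ ⟩
      Q ++ mapMaybe edge₁ (concat (zipWith chunk Qs Ps))
        ≡⟨ cong (Q ++_) (chunks Qs Ps (suc-injective Qs≡Ps)) ⟩
      Q ++ concat (map (uncurry _∷_) Qs) ∎)

  mapMaybe-edge₂ : length Qs ≡ length Ps → mapMaybe edge₂ edgeList ≡ B.sortedEdges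
  mapMaybe-edge₂ Qs≡Ps = begin
    mapMaybe edge₂ (map right P₀ ++ map left Q₀ ++ concat (zipWith chunk Qs Ps))
      ≡⟨ mapMaybe-map-++-just edge₂ right (λ _ → refl) P₀ _ ⟩
    P₀ ++ mapMaybe edge₂ (map left Q₀ ++ concat (zipWith chunk Qs Ps))
      ≡⟨ cong (P₀ ++_) (mapMaybe-map-++-nothing edge₂ left (λ _ → refl) Q₀ _) ⟩
    P₀ ++ mapMaybe edge₂ (concat (zipWith chunk Qs Ps))
      ≡⟨ cong (P₀ ++_) (chunks Qs Ps Qs≡Ps) ⟩
    P₀ ++ concat (map (uncurry _∷_) Ps)
      ≡⟨ split-concat B.isInputEdge B.sortedEdges ⟩
    B.sortedEdges ∎
    where
    chunks : ∀ Qs Ps → length Qs ≡ length Ps →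
      mapMaybe edge₂ (concat (zipWith chunk Qs Ps)) ≡ concat (map (uncurry _∷_) Ps)
    chunks [] [] _ = refl
    chunks ((o , Q) ∷ Qs) ((i , P) ∷ Ps) Qs≡Ps = cong (i ∷_) (begin
      mapMaybe edge₂ ((map right P ++ map left Q) ++ concat (zipWith chunk Qs Ps))
        ≡⟨ cong (mapMaybe edge₂) (++-assoc (map right P) (map left Q) _) ⟩
      mapMaybe edge₂ (map right P ++ map left Q ++ concat (zipWith chunk Qs Ps))
        ≡⟨ mapMaybe-map-++-just edge₂ right (λ _ → refl) P _ ⟩
      P ++ mapMaybe edge₂ (map left Q ++ concat (zipWith chunk Qs Ps))
        ≡⟨ cong (P ++_) (mapMaybe-map-++-nothing edge₂ left (λ _ → refl) Q _) ⟩
      P ++ mapMaybe edge₂ (concat (zipWith chunk Qs Ps))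
        ≡⟨ cong (P ++_) (chunks Qs Ps (suc-injective Qs≡Ps)) ⟩
      P ++ concat (map (uncurry _∷_) Ps) ∎)

module ComposedNesting (G₁ G₂ : OGraph)
    (G₁-upo : OGraph.AdmissibleUPO G₁) (G₂-upo : OGraph.AdmissibleUPO G₂)
    (arity : length (OGraph.outputEdges G₁) ≡ length (OGraph.inputEdges G₂)) where
  private
    module A = OGraph G₁
    module B = OGraph G₂
    module A⁺ = UPOProperties G₁ G₁-upo
    module B⁺ = UPOProperties G₂ G₂-upo
  open Compose G₁ G₂
  open ComposedEdges G₁ G₂
  open EdgeHull src tgt _≺_

  origin : Fin nE → CEdge A.nE B.nE
  origin p = lookup edgeList p

  private
    blocks : length (proj₂ Qblocks) ≡ length (proj₂ Pblocks)
    blocks = trans (length-split A.isOutputEdge A.sortedEdges)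
               (trans arity (sym (length-split B.isInputEdge B.sortedEdges)))

  edge₁-monotone : ∀ {p q a b} → p Fin.< q →
    edge₁ (origin p) ≡ just a → edge₁ (origin q) ≡ just b → a A.≺ b
  edge₁-monotone = lookup-mapMaybe-AllPairs edge₁ edgeList
    (subst (AllPairs A._≺_) (sym (mapMaybe-edge₁ blocks)) A⁺.sortedEdges-sorted)

  edge₂-monotone : ∀ {p q a b} → p Fin.< q →
    edge₂ (origin p) ≡ just a → edge₂ (origin q) ≡ just b → a B.≺ b
  edge₂-monotone = lookup-mapMaybe-AllPairs edge₂ edgeList
    (subst (AllPairs B._≺_) (sym (mapMaybe-edge₂ blocks)) B⁺.sortedEdges-sorted)

  edge₁-surjective : ∀ a → ∃ λ p → edge₁ (origin p) ≡ just a
  edge₁-surjective a =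
    ∈-mapMaybe⁻ edge₁ edgeList (subst (a ∈_) (sym (mapMaybe-edge₁ blocks)) (A⁺.∈-sortedEdges a))

  edge₂-surjective : ∀ b → ∃ λ p → edge₂ (origin p) ≡ just b
  edge₂-surjective b =
    ∈-mapMaybe⁻ edge₂ edgeList (subst (b ∈_) (sym (mapMaybe-edge₂ blocks)) (B⁺.∈-sortedEdges b))

  open HullTransfer G₁ src tgt (edge₁ ∘ origin) edge₁-monotone
    renaming (≼-reflect to ≼-reflect₁; hull-transfer to hull-transfer₁)
  open HullTransfer G₂ src tgt (edge₂ ∘ origin) edge₂-monotone
    renaming (≼-reflect to ≼-reflect₂; hull-transfer to hull-transfer₂)

  classified : ∀ p → Classified (origin p)
  classified p = All.lookup classified-edgeList (∈-lookup p)

  left-inner : ∀ {p a} → origin p ≡ left a → A.σ (A.tgt a) ≡ false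
  left-inner {p} cp = subst Classified cp (classified p)

  right-inner : ∀ {p b} → origin p ≡ right b → B.σ (B.src b) ≡ false
  right-inner {p} cp = subst Classified cp (classified p)

  glued-output : ∀ {p o i} → origin p ≡ glued o i → A.OG o
  glued-output {p} cp = proj₁ (subst Classified cp (classified p))

  glued-input : ∀ {p o i} → origin p ≡ glued o i → B.IG i
  glued-input {p} cp = proj₂ (subst Classified cp (classified p))

  left-lift : ∀ {a} → A.σ (A.tgt a) ≡ false → ∃ λ p → origin p ≡ left a
  left-lift {a} inner with edge₁-surjective a
  ... | p , ep with edge₁-view (origin p) ep
  ...   | inj₁ cp = p , cp
  ...   | inj₂ (i , cp) with () ← trans (sym inner) (glued-output cp)

  right-lift : ∀ {b} → B.σ (B.src b) ≡ false → ∃ λ p → origin p ≡ right b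
  right-lift {b} inner with edge₂-surjective b
  ... | p , ep with edge₂-view (origin p) ep
  ...   | inj₁ cp = p , cp
  ...   | inj₂ (o , cp) with () ← trans (sym inner) (glued-input cp)

  hull-In₁ : ∀ {x f a} → A.σ x ≡ false → edge₁ (origin f) ≡ just a →
    A.hull (A.In x) a → hull (In (inj₁ x)) f
  hull-In₁ inner = hull-transfer₁ λ ta →
    let p , cp = left-lift (subst (λ v → A.σ v ≡ false) (sym ta) inner)
    in p , cong edge₁ cp , trans (cong tgtC cp) (cong inj₁ ta)

  hull-Out₁ : ∀ {x f a} → edge₁ (origin f) ≡ just a → A.hull (A.Out x) a → hull (Out (inj₁ x)) f
  hull-Out₁ = hull-transfer₁ λ {a} sa →
    let p , ep = edge₁-surjective a in p , ep , trans (edge₁⇒src (origin p) ep) (cong inj₁ sa)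

  hull-In₂ : ∀ {y f b} → edge₂ (origin f) ≡ just b → B.hull (B.In y) b → hull (In (inj₂ y)) f
  hull-In₂ = hull-transfer₂ λ {b} tb →
    let p , ep = edge₂-surjective b in p , ep , trans (edge₂⇒tgt (origin p) ep) (cong inj₂ tb)

  hull-Out₂ : ∀ {y f b} → B.σ y ≡ false → edge₂ (origin f) ≡ just b →
    B.hull (B.Out y) b → hull (Out (inj₂ y)) f
  hull-Out₂ inner = hull-transfer₂ λ sb →
    let p , cp = right-lift (subst (λ v → B.σ v ≡ false) (sym sb) inner)
    in p , cong edge₂ cp , trans (cong srcC cp) (cong inj₂ sb)

  glued∉hull-In₁ : ∀ {p p′ g a a′} → origin p ≡ left a → origin p′ ≡ left a′ → A.tgt a ≡ A.tgt a′ →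
    Glued (origin g) → p Fin.< g → g Fin.< p′ → ⊥
  glued∉hull-In₁ cp cp′ ta≡ (o , i , cg) p<g g<p′ =
    A⁺.output∉hull-In (left-inner cp) (glued-output cg)
      (A⁺.between⇒hull refl (sym ta≡) (edge₁-monotone p<g (cong edge₁ cp) (cong edge₁ cg))
                                      (edge₁-monotone g<p′ (cong edge₁ cg) (cong edge₁ cp′)))

  glued∉hull-Out₂ : ∀ {p p′ g b b′} →
    origin p ≡ right b → origin p′ ≡ right b′ → B.src b ≡ B.src b′ →
    Glued (origin g) → p Fin.< g → g Fin.< p′ → ⊥
  glued∉hull-Out₂ cp cp′ sb≡ (o , i , cg) p<g g<p′ =
    B⁺.input∉hull-Out (right-inner cp) (glued-input cg)
      (B⁺.between⇒hull refl (sym sb≡) (edge₂-monotone p<g (cong edge₂ cp) (cong edge₂ cg))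
                                      (edge₂-monotone g<p′ (cong edge₂ cg) (cong edge₂ cp′)))

  EndsIn₂ : Fin nE → Set
  EndsIn₂ q = ∃ λ w → tgt q ≡ inj₂ w

  StartsIn₁ : Fin nE → Set
  StartsIn₁ q = ∃ λ v → src q ≡ inj₁ v

  In₁-unseparated : ∀ {x p p′ q} → tgt p ≡ inj₁ x → tgt p′ ≡ inj₁ x → EndsIn₂ q →
    p Fin.< q → q Fin.< p′ → ⊥
  In₁-unseparated {p = p} {p′} {q} tp tp′ (w , tq) p<q q<p′
    with tgt≡inj₁ (origin p) tp | tgt≡inj₁ (origin p′) tp′ | tgt≡inj₂ (origin q) tq
  ... | a , cp , ta | a′ , cp′ , ta′ | b , eq , _ with edge₂-view (origin q) eq
  ...   | inj₂ (o , cq) = glued∉hull-In₁ cp cp′ (trans ta (sym ta′)) (o , b , cq) p<q q<p′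
  ...   | inj₁ cq =
    let g , p<g , g<q , gg = glued-between separated-edgeList p<q cp cq
    in glued∉hull-In₁ cp cp′ (trans ta (sym ta′)) gg p<g (Finₚ.<-trans g<q q<p′)

  Out₂-unseparated : ∀ {y p p′ q} → src p ≡ inj₂ y → src p′ ≡ inj₂ y → StartsIn₁ q →
    p Fin.< q → q Fin.< p′ → ⊥
  Out₂-unseparated {p = p} {p′} {q} sp sp′ (v , sq) p<q q<p′
    with src≡inj₂ (origin p) sp | src≡inj₂ (origin p′) sp′ | src≡inj₁ (origin q) sq
  ... | b , cp , sb | b′ , cp′ , sb′ | a , eq , _ with edge₁-view (origin q) eq
  ...   | inj₂ (i , cq) = glued∉hull-Out₂ cp cp′ (trans sb (sym sb′)) (a , i , cq) p<q q<p′
  ...   | inj₁ cq =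
    let g , q<g , g<p′ , gg = glued-between separated-edgeList q<p′ cq cp′
    in glued∉hull-Out₂ cp cp′ (trans sb (sym sb′)) gg (Finₚ.<-trans p<q q<g) g<p′

  In₁-same-side : ∀ {x p p′ q} → tgt p ≡ inj₁ x → tgt p′ ≡ inj₁ x → EndsIn₂ q →
    (q Fin.< p → q Fin.< p′) × (p Fin.< q → p′ Fin.< q)
  In₁-same-side {x} = same-side {X = λ p → tgt p ≡ inj₁ x} {Y = EndsIn₂} In₁-unseparated
    λ tp (w , tq) → inj₁≢inj₂ (trans (sym tp) tq)

  Out₂-same-side : ∀ {y p p′ q} → src p ≡ inj₂ y → src p′ ≡ inj₂ y → StartsIn₁ q →
    (q Fin.< p → q Fin.< p′) × (p Fin.< q → p′ Fin.< q)
  Out₂-same-side {y} = same-side {X = λ p → src p ≡ inj₂ y} {Y = StartsIn₁} Out₂-unseparated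
    λ sp (v , sq) → inj₁≢inj₂ (trans (sym sq) sp)

  nesting-In : ∀ {e₁ e e₂} → e₁ Fin.< e → e Fin.< e₂ →
    ∀ v → tgt e₁ ≡ v → tgt e₂ ≡ v → In (tgt e) ⊆ hull (In v)
  nesting-In {e₁} {e} {e₂} e₁<e e<e₂ (inj₁ x) t₁ t₂ with tgt e in te
  ... | inj₂ w = ⊥-elim (In₁-unseparated t₁ t₂ (w , te) e₁<e e<e₂)
  ... | inj₁ x′ with tgt≡inj₁ (origin e₁) t₁ | tgt≡inj₁ (origin e) te | tgt≡inj₁ (origin e₂) t₂
  ...   | a₁ , c₁ , ta₁ | a , ce , ta | a₂ , c₂ , ta₂ = λ f tf →
    let a′ , cf , ta′ = tgt≡inj₁ (origin f) tf
        a∈ = A⁺.between⇒hull ta₁ ta₂ (edge₁-monotone e₁<e (cong edge₁ c₁) (cong edge₁ ce))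
                                     (edge₁-monotone e<e₂ (cong edge₁ ce) (cong edge₁ c₂))
    in hull-In₁ (subst (λ v → A.σ v ≡ false) ta₁ (left-inner c₁)) (cong edge₁ cf)
                (A⁺.hull-In-nested a∈ a′ (trans ta′ (sym ta)))
  nesting-In {e₁} {e} {e₂} e₁<e e<e₂ (inj₂ y) t₁ t₂ with tgt e in te
  ... | inj₁ x′ = λ f tf → between⇒hull t₁ t₂ (proj₁ (In₁-same-side te tf (y , t₁)) e₁<e)
                                              (proj₂ (In₁-same-side te tf (y , t₂)) e<e₂)
  ... | inj₂ y′ with tgt≡inj₂ (origin e₁) t₁ | tgt≡inj₂ (origin e) te | tgt≡inj₂ (origin e₂) t₂
  ...   | b₁ , c₁ , tb₁ | b , ce , tb | b₂ , c₂ , tb₂ = λ f tf →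
    let b′ , cf , tb′ = tgt≡inj₂ (origin f) tf
        b∈ = B⁺.between⇒hull tb₁ tb₂ (edge₂-monotone e₁<e c₁ ce) (edge₂-monotone e<e₂ ce c₂)
    in hull-In₂ cf (B⁺.hull-In-nested b∈ b′ (trans tb′ (sym tb)))

  nesting-Out : ∀ {e₁ e e₂} → e₁ Fin.< e → e Fin.< e₂ →
    ∀ v → src e₁ ≡ v → src e₂ ≡ v → Out (src e) ⊆ hull (Out v)
  nesting-Out {e₁} {e} {e₂} e₁<e e<e₂ (inj₂ y) s₁ s₂ with src e in se
  ... | inj₁ v = ⊥-elim (Out₂-unseparated s₁ s₂ (v , se) e₁<e e<e₂)
  ... | inj₂ y′ with src≡inj₂ (origin e₁) s₁ | src≡inj₂ (origin e) se | src≡inj₂ (origin e₂) s₂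
  ...   | b₁ , c₁ , sb₁ | b , ce , sb | b₂ , c₂ , sb₂ = λ f sf →
    let b′ , cf , sb′ = src≡inj₂ (origin f) sf
        b∈ = B⁺.between⇒hull sb₁ sb₂ (edge₂-monotone e₁<e (cong edge₂ c₁) (cong edge₂ ce))
                                     (edge₂-monotone e<e₂ (cong edge₂ ce) (cong edge₂ c₂))
    in hull-Out₂ (subst (λ w → B.σ w ≡ false) sb₁ (right-inner c₁)) (cong edge₂ cf)
                 (B⁺.hull-Out-nested b∈ b′ (trans sb′ (sym sb)))
  nesting-Out {e₁} {e} {e₂} e₁<e e<e₂ (inj₁ x) s₁ s₂ with src e in se
  ... | inj₂ y′ = λ f sf → between⇒hull s₁ s₂ (proj₁ (Out₂-same-side se sf (x , s₁)) e₁<e)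
                                              (proj₂ (Out₂-same-side se sf (x , s₂)) e<e₂)
  ... | inj₁ x′ with src≡inj₁ (origin e₁) s₁ | src≡inj₁ (origin e) se | src≡inj₁ (origin e₂) s₂
  ...   | a₁ , c₁ , sa₁ | a , ce , sa | a₂ , c₂ , sa₂ = λ f sf →
    let a′ , cf , sa′ = src≡inj₁ (origin f) sf
        a∈ = A⁺.between⇒hull sa₁ sa₂ (edge₁-monotone e₁<e c₁ ce) (edge₁-monotone e<e₂ ce c₂)
    in hull-Out₁ cf (A⁺.hull-Out-nested a∈ a′ (trans sa′ (sym sa)))

  nesting-InOut₁ : ∀ {e₁ e e₂ x} → e₁ Fin.< e → e Fin.< e₂ → tgt e₁ ≡ inj₁ x → src e₂ ≡ inj₁ x →
    (In (tgt e) ⊆ hull (In (inj₁ x))) ⊎ (Out (src e) ⊆ hull (Out (inj₁ x)))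
  nesting-InOut₁ {e₁} {e} {e₂} e₁<e e<e₂ t₁ s₂
    with tgt≡inj₁ (origin e₁) t₁ | src≡inj₁ (origin e₂) s₂ | src e in se
  ... | a₁ , c₁ , refl | a₂ , e₂a , sa₂ | inj₁ x′ with src≡inj₁ (origin e) se
  ...   | a , ea , sa
    with A⁺.between-In-Out⇒hull refl sa₂ (edge₁-monotone e₁<e (cong edge₁ c₁) ea)
                                         (edge₁-monotone e<e₂ ea e₂a)
  ...     | inj₂ a∈Out = inj₂ λ f sf →
    let a′ , fa , sa′ = src≡inj₁ (origin f) sf
    in hull-Out₁ fa (A⁺.hull-Out-nested a∈Out a′ (trans sa′ (sym sa)))
  ...     | inj₁ a∈In with edge₁-view (origin e) ea
  ...       | inj₂ (i , ce) = ⊥-elim (A⁺.output∉hull-In (left-inner c₁) (glued-output ce) a∈In)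
  ...       | inj₁ ce = inj₁ λ f tf →
    let a′ , cf , ta′ = tgt≡inj₁ (origin f) (trans tf (cong tgtC ce))
    in hull-In₁ (left-inner c₁) (cong edge₁ cf) (A⁺.hull-In-nested a∈In a′ ta′)
  nesting-InOut₁ {e₁} {e} {e₂} e₁<e e<e₂ t₁ s₂ | a₁ , c₁ , refl | a₂ , e₂a , sa₂ | inj₂ y′
    with src≡inj₂ (origin e) se
  ... | b , ce , _ with glued-between separated-edgeList e₁<e c₁ ce
  ...   | g , e₁<g , g<e , o , i , cg
    with A⁺.between-In-Out⇒hull refl sa₂ (edge₁-monotone e₁<g (cong edge₁ c₁) (cong edge₁ cg))
                              (edge₁-monotone (Finₚ.<-trans g<e e<e₂) (cong edge₁ cg) e₂a)
  ...     | inj₁ o∈In = ⊥-elim (A⁺.output∉hull-In (left-inner c₁) (glued-output cg) o∈In)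
  ...     | inj₂ (d , _ , sd , _ , d≼o , _) = inj₂ λ f sf →
    let p , pd = edge₁-surjective d
        sp = trans (edge₁⇒src (origin p) pd) (cong inj₁ sd)
        p<e = ≼-<-trans (≼-reflect₁ pd (cong edge₁ cg) d≼o) g<e
    in between⇒hull sp s₂ (proj₁ (Out₂-same-side se sf (_ , sp)) p<e)
                           (proj₂ (Out₂-same-side se sf (_ , s₂)) e<e₂)

  nesting-InOut₂ : ∀ {e₁ e e₂ y} → e₁ Fin.< e → e Fin.< e₂ → tgt e₁ ≡ inj₂ y → src e₂ ≡ inj₂ y →
    (In (tgt e) ⊆ hull (In (inj₂ y))) ⊎ (Out (src e) ⊆ hull (Out (inj₂ y)))
  nesting-InOut₂ {e₁} {e} {e₂} e₁<e e<e₂ t₁ s₂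
    with tgt≡inj₂ (origin e₁) t₁ | src≡inj₂ (origin e₂) s₂ | tgt e in te
  ... | b₁ , e₁b , tb₁ | b₂ , c₂ , refl | inj₂ y′ with tgt≡inj₂ (origin e) te
  ...   | b , eb , tb
    with B⁺.between-In-Out⇒hull tb₁ refl (edge₂-monotone e₁<e e₁b eb)
                                         (edge₂-monotone e<e₂ eb (cong edge₂ c₂))
  ...     | inj₁ b∈In = inj₁ λ f tf →
    let b′ , fb , tb′ = tgt≡inj₂ (origin f) tf
    in hull-In₂ fb (B⁺.hull-In-nested b∈In b′ (trans tb′ (sym tb)))
  ...     | inj₂ b∈Out with edge₂-view (origin e) eb
  ...       | inj₂ (o , ce) = ⊥-elim (B⁺.input∉hull-Out (right-inner c₂) (glued-input ce) b∈Out)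
  ...       | inj₁ ce = inj₂ λ f sf →
    let b′ , cf , sb′ = src≡inj₂ (origin f) (trans sf (cong srcC ce))
    in hull-Out₂ (right-inner c₂) (cong edge₂ cf) (B⁺.hull-Out-nested b∈Out b′ sb′)
  nesting-InOut₂ {e₁} {e} {e₂} e₁<e e<e₂ t₁ s₂ | b₁ , e₁b , tb₁ | b₂ , c₂ , refl | inj₁ x′
    with tgt≡inj₁ (origin e) te
  ... | a , ce , _ with glued-between separated-edgeList e<e₂ ce c₂
  ...   | g , e<g , g<e₂ , o , i , cg
    with B⁺.between-In-Out⇒hull tb₁ refl
           (edge₂-monotone (Finₚ.<-trans e₁<e e<g) e₁b (cong edge₂ cg))
                              (edge₂-monotone g<e₂ (cong edge₂ cg) (cong edge₂ c₂))
  ...     | inj₂ i∈Out = ⊥-elim (B⁺.input∉hull-Out (right-inner c₂) (glued-input cg) i∈Out)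
  ...     | inj₁ (_ , d , _ , td , _ , i≼d) = inj₁ λ f tf →
    let p , pd = edge₂-surjective d
        tp = trans (edge₂⇒tgt (origin p) pd) (cong inj₂ td)
        e<p = <-≼-trans e<g (≼-reflect₂ (cong edge₂ cg) pd i≼d)
    in between⇒hull t₁ tp (proj₁ (In₁-same-side te tf (_ , t₁)) e₁<e)
                           (proj₂ (In₁-same-side te tf (_ , tp)) e<p)

  nesting : Nesting
  nesting e₁ e e₂ e₁<e e<e₂ = nesting-In e₁<e e<e₂ , nesting-Out e₁<e e<e₂ , nesting-InOut
    where
    nesting-InOut : ∀ v → tgt e₁ ≡ v → src e₂ ≡ v →
      (In (tgt e) ⊆ hull (In v)) ⊎ (Out (src e) ⊆ hull (Out v))
    nesting-InOut (inj₁ x) = nesting-InOut₁ e₁<e e<e₂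
    nesting-InOut (inj₂ y) = nesting-InOut₂ e₁<e e<e₂

proposition5p4 : (G₁ G₂ : OGraph)
    → OGraph.AdmissibleUPO G₁ → OGraph.AdmissibleUPO G₂
    → (n : ℕ) → length (OGraph.outputEdges G₁) ≡ n → length (OGraph.inputEdges G₂) ≡ n
    → Compose.Nesting G₁ G₂
proposition5p4 G₁ G₂ G₁-upo G₂-upo n outputs≡n inputs≡n =
  ComposedNesting.nesting G₁ G₂ G₁-upo G₂-upo (trans outputs≡n (sym inputs≡n))
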